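{- Let $k>t\ge1$ and let $r\ge7$ be an integer with $r\equiv1\pmod3$, and set $s=\lceil r/3\rceil$. Let $\mathcal{I}_1,\dots,\mathcal{I}_s\subseteq\binom{[n]}{k}$ be $t$-stars with centres $T_1,\dots,T_s$ such that $|T_i\cap T_j|\le\max(0,2t-k-1)$ for all $1\le i<j\le s$. Let $\mathcal{F}=\mathcal{I}_1\cup\dots\cup\mathcal{I}_{s-1}$ and $\tilde{\mathcal{F}}=\mathcal{I}_1\cup\dots\cup\mathcal{I}_s$. Let $\vec C=(C_1,\dots,C_{s-1})$ be an ordered partition of $\{1,\dots,r\}$ into $s-1$ parts with $|C_1|=4$ and $|C_i|=3$ for $2\le i\le s-1$, and let $\vec{C}'=(C'_1,C_2,\dots,C_{s-1},C'_s)$ where $C'_1\cup C'_s$ is an arbitrary partition of $C_1$ into two sets of size two. Let $\Phi(\vec C)$ be the set of maps $\varphi:\mathcal{F}\to\{1,\dots,r\}$ with $\varphi(F)\in\bigcup_{i\le s-1:F\in\mathcal{I}_i}C_i$ for all $F\in\mathcal{F}$, and $\tilde\Phi(\vec C')$ the set of maps $\varphi:\tilde{\mathcal{F}}\to\{1,\dots,r\}$ with $\varphi(F)\in\bigcup_{i\le s:F\in\mathcal{I}_i}C'_i$ for all $F\in\tilde{\mathcal{F}}$ (where $C'_i=C_i$ for $2\le i\le s-1$). Then $|\tilde\Phi(\vec C')|\ge|\Phi(\vec C)|$.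
   Context: A $t$-star with centre $T$ ($T\subseteq[n]$, $|T|=t$) is the family of all $k$-subsets of $[n]$ containing $T$. -}

module Defs where

open import Data.Nat using (ℕ; zero; suc; _+_; _∸_; _≡ᵇ_)
open import Data.Nat.DivMod using (_/_)
open import Data.Bool using (Bool; true; false; _∧_; if_then_else_)
open import Data.Fin using (Fin)
open import Data.Fin.Subset using (Subset; ∣_∣; outside; inside)
open import Data.Fin.Subset.Properties using (_⊆?_; _∈?_)
open import Data.List using (List; []; _∷_; map; _++_; concatMap; length; upTo; zip; allFin)
open import Data.Bool.ListAction using (any; all)
open import Data.Product using (_,_)
open import Data.Vec using (_∷_)
open import Relation.Nullary using (does)

⌈_/3⌉ : ℕ → ℕ
⌈ r /3⌉ = (r + 2) / 3

range : ℕ → ℕ → List ℕ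
range a b = map (a +_) (upTo (suc b ∸ a))

inStarᵇ : {n : ℕ} → ℕ → Subset n → Subset n → Bool
inStarᵇ k T F = (∣ F ∣ ≡ᵇ k) ∧ does (T ⊆? F)

inUnionᵇ : {n : ℕ} → ℕ → (ℕ → Subset n) → List ℕ → Subset n → Bool
inUnionᵇ k T idx F = any (λ i → inStarᵇ k (T i) F) idx

allowedᵇ : {n r : ℕ} → ℕ → (ℕ → Subset n) → (ℕ → Subset r) → List ℕ
         → Subset n → Fin r → Bool
allowedᵇ k T C idx F c = any (λ i → inStarᵇ k (T i) F ∧ does (c ∈? C i)) idx

allSubsets : (n : ℕ) → List (Subset n)
allSubsets zero = Data.Vec.[] ∷ []
allSubsets (suc n) = map (inside ∷_) (allSubsets n) ++ map (outside ∷_) (allSubsets n)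

filterᵇ : {A : Set} → (A → Bool) → List A → List A
filterᵇ p [] = []
filterᵇ p (x ∷ xs) = if p x then x ∷ filterᵇ p xs else filterᵇ p xs

allMaps : (r m : ℕ) → List (List (Fin r))
allMaps r zero = [] ∷ []
allMaps r (suc m) = concatMap (λ c → map (c ∷_) (allMaps r m)) (allFin r)

family : (n : ℕ) → ℕ → (ℕ → Subset n) → List ℕ → List (Subset n)
family n k T idx = filterᵇ (inUnionᵇ k T idx) (allSubsets n)

-- A map is represented by its list of values along the enumeration `family`.
numMaps : (n r : ℕ) → ℕ → (ℕ → Subset n) → (ℕ → Subset r) → List ℕ → ℕ
numMaps n r k T C idx =
  length (filterᵇ valid (allMaps r (length D)))
  where
    D = family n k T idx
    valid : List (Fin r) → Bool
    valid φ = all (λ { (F , c) → allowedᵇ k T C idx F c }) (zip D φ)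

modParts : {r : ℕ} → ℕ → (ℕ → Subset r) → Subset r → Subset r → ℕ → Subset r
modParts s C A B i = if i ≡ᵇ 1 then A else (if i ≡ᵇ s then B else C i)

module Submission where

-- Both sides factor over the k-sets F as products of the number of colours admissible for F.
-- A permutation of [n] exchanging T₁ ∖ Tₛ with Tₛ ∖ T₁ induces an involution σ on subsets that
-- swaps the stars I₁ and Iₛ. Let M(F) count the admissible colours of F outside C₁. For F in
-- I₁ ∪ Iₛ we have M(σF) = M(F): if 2t − k − 1 ≤ 0 the centres are disjoint, so T₂, …, Tₛ₋₁ are
-- fixed by the permutation; otherwise no k-set lies in two stars and M vanishes on I₁ ∪ Iₛ.
-- Such an F contributes at most max(4[F ∈ I₁] + M, 1) before and exactly
-- 2[F ∈ I₁] + 2[F ∈ Iₛ] + M after splitting C₁, and every other set contributes equally.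
-- So each pair F, σF gains, the worst case being (4 + M)·max(M, 1) ≤ (2 + M)², and taking the
-- product over all F bounds the square of the left side by the square of the right.

open import Defs
open import Data.Bool using (Bool; true; false; _∧_; _∨_; not; if_then_else_)
import Data.Bool
open import Data.Bool.Properties using (∧-identityʳ; ∧-zeroʳ; ∧-comm; ∨-comm; ⇔→≡)
open import Data.Bool.ListAction using (any; all)
open import Data.Empty using (⊥-elim)
open import Data.Fin using (Fin; zero; suc)
import Data.Fin.Properties as Fin
open import Data.Fin.Subset using (Subset; inside; outside; ∣_∣; _∩_; _∪_; _∈_; _∉_; _⊆_; ⊥)
open import Data.Fin.Subset.Properties
  using (_∈?_; _⊆?_; ∉⊥; x∈p∩q⁺; x∈p∪q⁺; x∈p∪q⁻; p⊆q⇒∣p∣≤∣q∣; ∣⁅x⁆∣≡1; x∈⁅y⁆⇒x≡y)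
open import Data.List using (List; []; _∷_; map; _++_; length; concatMap; zip; allFin)
open import Data.List.Properties using (map-∘; map-tabulate)
open import Data.List.Membership.Propositional using () renaming (_∈_ to _∈ˡ_; _∉_ to _∉ˡ_)
open import Data.List.Membership.Propositional.Properties
  using (∈-map⁺; ∈-map⁻; ∈-++⁺ˡ; ∈-++⁺ʳ; ∈-allFin; ∈-upTo⁺; ∈-upTo⁻)
open import Data.List.Membership.Propositional.Properties.WithK using (unique∧set⇒bag)
open import Data.List.Relation.Binary.BagAndSetEquality using (∼bag⇒↭)
open import Data.List.Relation.Binary.Disjoint.Propositional using (Disjoint)
open import Data.List.Relation.Binary.Permutation.Propositional using (_↭_)
import Data.List.Relation.Binary.Permutation.Propositional.Properties as ↭
import Data.List.Relation.Unary.All as All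
open import Data.List.Relation.Unary.AllPairs using ([]; _∷_)
open import Data.List.Relation.Unary.Any using (here; there)
open import Data.List.Relation.Unary.Unique.Propositional using (Unique)
import Data.List.Relation.Unary.Unique.Propositional.Properties as Unique
open import Data.Nat using (ℕ; zero; suc; pred; _+_; _*_; _∸_; _⊔_; _≤_; _<_; z≤n; s≤s; _≡ᵇ_; _%_)
open import Data.Nat.Properties
  using ( ≤-refl; ≤-trans; ≤-reflexive; <-irrefl; <⇒≤; ≤∧≢⇒<; ≰⇒>; ≤⇒≯; _≤?_; +-suc; +-identityʳ
        ; +-cancelˡ-≡; *-mono-≤; *-mono-<; *-comm; m≤m+n; m≤m⊔n; m≤n⊔m; ⊔-identityʳ
        ; m∸n≤m; +-monoˡ-≤; m∸n≢0⇒n<m; m≤o∸n⇒m+n≤o; ≡ᵇ⇒≡; ≡⇒≡ᵇ; module ≤-Reasoning)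
  renaming (_≟_ to _≟ℕ_)
open import Data.Nat.DivMod using (/-monoˡ-≤)
open import Data.Nat.ListAction using (sum; product)
open import Data.Nat.ListAction.Properties using (sum-↭; product-↭)
open import Data.Nat.Tactic.RingSolver using (solve-∀)
open import Data.Product using (Σ; _×_; _,_; proj₁; proj₂)
open import Data.Sum using (_⊎_; inj₁; inj₂; [_,_])
open import Data.Unit using (tt)
open import Data.Vec using ([]; _∷_; lookup; tabulate)
open import Data.Vec.Properties using (lookup∘tabulate; tabulate∘lookup; tabulate-cong; []=⇒lookup; lookup⇒[]=)
open import Function using (_∘_)
open import Function.Bundles using (mk⇔)
open import Relation.Binary.Definitions using (DecidableEquality)
open import Relation.Binary.PropositionalEquality
  using (_≡_; _≢_; refl; sym; trans; cong; cong₂; subst; subst₂; module ≡-Reasoning)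
open import Relation.Nullary using (¬_; Dec; yes; no; does)
open import Relation.Nullary.Decidable using (dec-true; does-⇔)

countᵇ : {A : Set} → (A → Bool) → List A → ℕ
countᵇ p xs = length (filterᵇ p xs)

module _ {A : Set} where

  countᵇ-cong : {p q : A → Bool} → (∀ x → p x ≡ q x) → ∀ xs → countᵇ p xs ≡ countᵇ q xs
  countᵇ-cong e [] = refl
  countᵇ-cong {p} {q} e (x ∷ xs) with p x | q x | e x
  ... | true  | .true  | refl = cong suc (countᵇ-cong e xs)
  ... | false | .false | refl = countᵇ-cong e xs

  countᵇ-split : ∀ (b p : A → Bool) xs →
    countᵇ p xs ≡ countᵇ (λ x → b x ∧ p x) xs + countᵇ (λ x → not (b x) ∧ p x) xs
  countᵇ-split b p [] = refl
  countᵇ-split b p (x ∷ xs) with b x | p x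
  ... | true  | true  = cong suc (countᵇ-split b p xs)
  ... | false | true  = trans (cong suc (countᵇ-split b p xs)) (sym (+-suc _ _))
  ... | true  | false = countᵇ-split b p xs
  ... | false | false = countᵇ-split b p xs

  countᵇ-zero : ∀ {p : A → Bool} → (∀ x → p x ≡ false) → ∀ xs → countᵇ p xs ≡ 0
  countᵇ-zero e [] = refl
  countᵇ-zero {p} e (x ∷ xs) with p x | e x
  ... | false | refl = countᵇ-zero e xs

  countᵇ-map : ∀ {B : Set} (p : B → Bool) (f : A → B) xs →
    countᵇ p (map f xs) ≡ countᵇ (p ∘ f) xs
  countᵇ-map p f [] = refl
  countᵇ-map p f (x ∷ xs) with p (f x)
  ... | true  = cong suc (countᵇ-map p f xs)
  ... | false = countᵇ-map p f xs

  countᵇ≡sum : ∀ (p : A → Bool) xs → countᵇ p xs ≡ sum (map (λ x → if p x then 1 else 0) xs)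
  countᵇ≡sum p [] = refl
  countᵇ≡sum p (x ∷ xs) with p x
  ... | true  = cong suc (countᵇ≡sum p xs)
  ... | false = countᵇ≡sum p xs

  countᵇ-++ : ∀ (p : A → Bool) xs ys → countᵇ p (xs ++ ys) ≡ countᵇ p xs + countᵇ p ys
  countᵇ-++ p [] ys = refl
  countᵇ-++ p (x ∷ xs) ys with p x
  ... | true  = cong suc (countᵇ-++ p xs ys)
  ... | false = countᵇ-++ p xs ys

  product-map-filterᵇ : ∀ (p : A → Bool) (f : A → ℕ) xs →
    product (map f (filterᵇ p xs)) ≡ product (map (λ x → if p x then f x else 1) xs)
  product-map-filterᵇ p f [] = refl
  product-map-filterᵇ p f (x ∷ xs) with p x
  ... | true  = cong (f x *_) (product-map-filterᵇ p f xs)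
  ... | false = trans (product-map-filterᵇ p f xs) (sym (+-identityʳ _))

  ∈-filterᵇ⁺ : ∀ (p : A → Bool) {xs z} → z ∈ˡ xs → p z ≡ true → z ∈ˡ filterᵇ p xs
  ∈-filterᵇ⁺ p {x ∷ xs} (here refl) e rewrite e = here refl
  ∈-filterᵇ⁺ p {x ∷ xs} (there z∈xs) e with p x
  ... | true  = there (∈-filterᵇ⁺ p z∈xs e)
  ... | false = ∈-filterᵇ⁺ p z∈xs e

  ∈-filterᵇ⁻ : ∀ (p : A → Bool) {xs z} → z ∈ˡ filterᵇ p xs → z ∈ˡ xs × p z ≡ true
  ∈-filterᵇ⁻ p {x ∷ xs} z∈ with p x in px
  ∈-filterᵇ⁻ p {x ∷ xs} (here refl) | true = here refl , px
  ∈-filterᵇ⁻ p {x ∷ xs} (there z∈) | true = let (z∈xs , pz) = ∈-filterᵇ⁻ p z∈ in there z∈xs , pz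
  ∈-filterᵇ⁻ p {x ∷ xs} z∈ | false = let (z∈xs , pz) = ∈-filterᵇ⁻ p z∈ in there z∈xs , pz

  filterᵇ-unique : ∀ (p : A → Bool) {xs} → Unique xs → Unique (filterᵇ p xs)
  filterᵇ-unique p {[]} [] = []
  filterᵇ-unique p {x ∷ xs} (x∉xs ∷ xs!) with p x
  ... | true  = All.tabulate (All.lookup x∉xs ∘ proj₁ ∘ ∈-filterᵇ⁻ p) ∷ filterᵇ-unique p xs!
  ... | false = filterᵇ-unique p xs!

  any-true⁺ : ∀ (p : A → Bool) {xs i} → i ∈ˡ xs → p i ≡ true → any p xs ≡ true
  any-true⁺ p {x ∷ xs} (here refl) pi rewrite pi = refl
  any-true⁺ p {x ∷ xs} (there i∈xs) pi with p x
  ... | true  = refl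
  ... | false = any-true⁺ p i∈xs pi

  any-true⁻ : ∀ (p : A → Bool) xs → any p xs ≡ true → Σ A (λ i → i ∈ˡ xs × p i ≡ true)
  any-true⁻ p (x ∷ xs) e with p x in px
  ... | true  = x , here refl , px
  ... | false = let (i , i∈xs , pi) = any-true⁻ p xs e in i , there i∈xs , pi

  any-cong : ∀ (p : A → Bool) xs ys → (∀ {i} → i ∈ˡ xs → p i ≡ true → i ∈ˡ ys) →
    (∀ {i} → i ∈ˡ ys → p i ≡ true → i ∈ˡ xs) → any p xs ≡ any p ys
  any-cong p xs ys xs→ys ys→xs = ⇔→≡ {z = true} (mk⇔ (transfer xs ys xs→ys) (transfer ys xs ys→xs))
    where
    transfer : ∀ xs ys → (∀ {i} → i ∈ˡ xs → p i ≡ true → i ∈ˡ ys) → any p xs ≡ true → any p ys ≡ true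
    transfer xs ys to e = let (i , i∈xs , pi) = any-true⁻ p xs e in any-true⁺ p (to i∈xs pi) pi

  any-∧-unique : ∀ (P Q : A → Bool) xs {j} → j ∈ˡ xs → Q j ≡ true →
    (∀ {i} → i ∈ˡ xs → Q i ≡ true → i ≡ j) → any (λ i → P i ∧ Q i) xs ≡ P j
  any-∧-unique P Q xs {j} j∈xs Qj Q-unique = ⇔→≡ {z = true} (mk⇔ onlyIf if′)
    where
    onlyIf : any (λ i → P i ∧ Q i) xs ≡ true → P j ≡ true
    onlyIf e with any-true⁻ (λ i → P i ∧ Q i) xs e
    ... | i , i∈xs , PQi with P i in Pi | Q i in Qi
    ...   | true | true = subst (λ i → P i ≡ true) (Q-unique i∈xs Qi) Pi
    if′ : P j ≡ true → any (λ i → P i ∧ Q i) xs ≡ true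
    if′ Pj = any-true⁺ (λ i → P i ∧ Q i) j∈xs (cong₂ _∧_ Pj Qj)

  product-map-* : ∀ (f g : A → ℕ) xs →
    product (map (λ x → f x * g x) xs) ≡ product (map f xs) * product (map g xs)
  product-map-* f g [] = refl
  product-map-* f g (x ∷ xs) = trans (cong (f x * g x *_) (product-map-* f g xs)) (interchange (f x) (g x) _ _)
    where
    interchange : ∀ a b c d → a * b * (c * d) ≡ a * c * (b * d)
    interchange = solve-∀

  product-map-mono-≤ : ∀ {f g : A → ℕ} → (∀ x → f x ≤ g x) → ∀ xs → product (map f xs) ≤ product (map g xs)
  product-map-mono-≤ f≤g [] = ≤-refl
  product-map-mono-≤ f≤g (x ∷ xs) = *-mono-≤ (f≤g x) (product-map-mono-≤ f≤g xs)

-- Counting admissible colourings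

module _ {X : Set} {r : ℕ} (g : X × Fin r → Bool) where

  countᵇ-allMaps : ∀ D → countᵇ (λ φ → all g (zip D φ)) (allMaps r (length D))
                 ≡ product (map (λ x → countᵇ (λ c → g (x , c)) (allFin r)) D)
  countᵇ-allMaps [] = refl
  countᵇ-allMaps (x ∷ D) =
    trans (choose (allFin r)) (cong (countᵇ (λ c → g (x , c)) (allFin r) *_) (countᵇ-allMaps D))
    where
    valid : List X → List (Fin r) → Bool
    valid D φ = all g (zip D φ)

    Φ = allMaps r (length D)

    extend : ∀ {c b} → g (x , c) ≡ b → ∀ L →
      countᵇ (valid (x ∷ D)) (map (c ∷_) L) ≡ (if b then countᵇ (valid D) L else 0)
    extend {b = true}  e [] = refl
    extend {b = false} e [] = refl
    extend {b = true}  e (φ ∷ L) rewrite e with valid D φ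
    ... | true  = cong suc (extend e L)
    ... | false = extend e L
    extend {b = false} e (φ ∷ L) rewrite e = extend e L

    choose : ∀ cs → countᵇ (valid (x ∷ D)) (concatMap (λ c → map (c ∷_) Φ) cs)
                  ≡ countᵇ (λ c → g (x , c)) cs * countᵇ (valid D) Φ
    choose [] = refl
    choose (c ∷ cs) with g (x , c) in e
    ... | true  = trans (countᵇ-++ (valid (x ∷ D)) (map (c ∷_) Φ) _) (cong₂ _+_ (extend e Φ) (choose cs))
    ... | false = trans (countᵇ-++ (valid (x ∷ D)) (map (c ∷_) Φ) _) (cong₂ _+_ (extend e Φ) (choose cs))

choices : {n r : ℕ} → ℕ → (ℕ → Subset n) → (ℕ → Subset r) → List ℕ → Subset n → ℕ
choices {r = r} k T C idx F = if inUnionᵇ k T idx F then countᵇ (allowedᵇ k T C idx F) (allFin r) else 1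

numMaps≡product : ∀ n r k (T : ℕ → Subset n) (C : ℕ → Subset r) idx →
  numMaps n r k T C idx ≡ product (map (choices k T C idx) (allSubsets n))
numMaps≡product n r k T C idx =
  trans (countᵇ-allMaps _ (family n k T idx))
        (product-map-filterᵇ (inUnionᵇ k T idx) (λ F → countᵇ (allowedᵇ k T C idx F) (allFin r)) (allSubsets n))

choices-≤ : ∀ {n r} k (T : ℕ → Subset n) (C : ℕ → Subset r) idx F →
  choices k T C idx F ≤ countᵇ (allowedᵇ k T C idx F) (allFin r) ⊔ 1
choices-≤ k T C idx F with inUnionᵇ k T idx F
... | true  = m≤m⊔n _ 1
... | false = m≤n⊔m _ 1

choices-inUnion : ∀ {n r} k (T : ℕ → Subset n) (C : ℕ → Subset r) idx {F} →
  inUnionᵇ k T idx F ≡ true → choices k T C idx F ≡ countᵇ (allowedᵇ k T C idx F) (allFin r)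
choices-inUnion k T C idx e rewrite e = refl

-- Pairing by an involution

∈-allSubsets : ∀ {n} (F : Subset n) → F ∈ˡ allSubsets n
∈-allSubsets []               = here refl
∈-allSubsets (inside ∷ F)  = ∈-++⁺ˡ (∈-map⁺ (inside ∷_) (∈-allSubsets F))
∈-allSubsets (outside ∷ F) = ∈-++⁺ʳ _ (∈-map⁺ (outside ∷_) (∈-allSubsets F))

allSubsets-unique : ∀ n → Unique (allSubsets n)
allSubsets-unique zero = All.[] ∷ []
allSubsets-unique (suc n) =
  Unique.++⁺ (Unique.map⁺ ∷-injectiveʳ (allSubsets-unique n)) (Unique.map⁺ ∷-injectiveʳ (allSubsets-unique n)) heads-differ
  where
  ∷-injectiveʳ : ∀ {b} {F G : Subset n} → b ∷ F ≡ b ∷ G → F ≡ G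
  ∷-injectiveʳ refl = refl
  heads-differ : Disjoint (map (inside ∷_) (allSubsets n)) (map (outside ∷_) (allSubsets n))
  heads-differ (F∈ , G∈) with ∈-map⁻ (inside ∷_) F∈ | ∈-map⁻ (outside ∷_) G∈
  ... | _ , _ , refl | _ , _ , ()

module _ {A : Set} {xs : List A} (xs! : Unique xs) (∈xs : ∀ x → x ∈ˡ xs)
         {σ : A → A} (σ-involutive : ∀ x → σ (σ x) ≡ x) where

  map-involution↭ : map σ xs ↭ xs
  map-involution↭ = ∼bag⇒↭ (unique∧set⇒bag (Unique.map⁺ σ-injective xs!) xs!
    (λ {x} → mk⇔ (λ _ → ∈xs x) (λ _ → subst (_∈ˡ map σ xs) (σ-involutive x) (∈-map⁺ σ (∈xs (σ x))))))
    where
    σ-injective : ∀ {x y} → σ x ≡ σ y → x ≡ y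
    σ-injective {x} {y} e = trans (sym (σ-involutive x)) (trans (cong σ e) (σ-involutive y))

  product-map-involution : ∀ (f : A → ℕ) → product (map (f ∘ σ) xs) ≡ product (map f xs)
  product-map-involution f = trans (cong product (map-∘ xs)) (product-↭ (↭.map⁺ f map-involution↭))

  product-≤-by-pairing : ∀ (f g : A → ℕ) → (∀ x → f x * f (σ x) ≤ g x * g (σ x)) →
    product (map f xs) ≤ product (map g xs)
  product-≤-by-pairing f g pair = m*m≤n*n⇒m≤n (begin
    product (map f xs) * product (map f xs)        ≡⟨ square f ⟨
    product (map (λ x → f x * f (σ x)) xs)         ≤⟨ product-map-mono-≤ pair xs ⟩
    product (map (λ x → g x * g (σ x)) xs)         ≡⟨ square g ⟩
    product (map g xs) * product (map g xs)        ∎)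
    where
    open ≤-Reasoning
    square : ∀ h → product (map (λ x → h x * h (σ x)) xs) ≡ product (map h xs) * product (map h xs)
    square h = trans (product-map-* h (h ∘ σ) xs) (cong (product (map h xs) *_) (product-map-involution h))
    m*m≤n*n⇒m≤n : ∀ {m n} → m * m ≤ n * n → m ≤ n
    m*m≤n*n⇒m≤n {m} {n} m²≤n² with m ≤? n
    ... | yes m≤n = m≤n
    ... | no m≰n  = ⊥-elim (≤⇒≯ m²≤n² (*-mono-< (≰⇒> m≰n) (≰⇒> m≰n)))

  countᵇ-involution : ∀ (p : A → Bool) → countᵇ (p ∘ σ) xs ≡ countᵇ p xs
  countᵇ-involution p = begin
    countᵇ (p ∘ σ) xs                                    ≡⟨ countᵇ-map p σ xs ⟨
    countᵇ p (map σ xs)                                  ≡⟨ countᵇ≡sum p (map σ xs) ⟩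
    sum (map (λ x → if p x then 1 else 0) (map σ xs))    ≡⟨ sum-↭ (↭.map⁺ _ map-involution↭) ⟩
    sum (map (λ x → if p x then 1 else 0) xs)            ≡⟨ countᵇ≡sum p xs ⟨
    countᵇ p xs                                          ∎
    where open ≡-Reasoning

countᵇ-allFin-suc : ∀ {n} (f : Fin (suc n) → Bool) →
  countᵇ f (allFin (suc n)) ≡ (if f zero then 1 else 0) + countᵇ (f ∘ suc) (allFin n)
countᵇ-allFin-suc {n} f with f zero
... | true  = cong suc (trans (cong (countᵇ f) (sym (map-tabulate (λ z → z) suc))) (countᵇ-map f suc (allFin n)))
... | false = trans (cong (countᵇ f) (sym (map-tabulate (λ z → z) suc))) (countᵇ-map f suc (allFin n))

∣p∣≡countᵇ-lookup : ∀ {n} (p : Subset n) → ∣ p ∣ ≡ countᵇ (lookup p) (allFin n)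
∣p∣≡countᵇ-lookup [] = refl
∣p∣≡countᵇ-lookup (inside ∷ p)  = trans (cong suc (∣p∣≡countᵇ-lookup p)) (sym (countᵇ-allFin-suc (lookup (inside ∷ p))))
∣p∣≡countᵇ-lookup (outside ∷ p) = trans (∣p∣≡countᵇ-lookup p) (sym (countᵇ-allFin-suc (lookup (outside ∷ p))))

does-∈?≡lookup : ∀ {n} (p : Subset n) z → does (z ∈? p) ≡ lookup p z
does-∈?≡lookup (inside  ∷ p) zero    = refl
does-∈?≡lookup (outside ∷ p) zero    = refl
does-∈?≡lookup (_       ∷ p) (suc z) = does-∈?≡lookup p z

countᵇ-∈? : ∀ {n} (p : Subset n) → countᵇ (λ z → does (z ∈? p)) (allFin n) ≡ ∣ p ∣
countᵇ-∈? {n} p = trans (countᵇ-cong (does-∈?≡lookup p) (allFin n)) (sym (∣p∣≡countᵇ-lookup p))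

countᵇ-∈?-∧ : ∀ {n m} (p : Subset n) → ∣ p ∣ ≡ m → ∀ b → countᵇ (λ z → does (z ∈? p) ∧ b) (allFin n) ≡ (if b then m else 0)
countᵇ-∈?-∧ {n} p refl true  = trans (countᵇ-cong (λ z → ∧-identityʳ (does (z ∈? p))) (allFin n)) (countᵇ-∈? p)
countᵇ-∈?-∧ {n} p refl false = countᵇ-zero (λ z → ∧-zeroʳ (does (z ∈? p))) (allFin n)

does-true⇒ : ∀ {P : Set} (P? : Dec P) → does P? ≡ true → P
does-true⇒ (yes p) _ = p

lookup-∉ : ∀ {n} {p : Subset n} {z} → z ∉ p → lookup p z ≡ outside
lookup-∉ {p = p} {z} z∉p with lookup p z in e
... | inside  = ⊥-elim (z∉p (lookup⇒[]= z p e))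
... | outside = refl

∣p∪q∣+∣p∩q∣≡∣p∣+∣q∣ : ∀ {n} (p q : Subset n) → ∣ p ∪ q ∣ + ∣ p ∩ q ∣ ≡ ∣ p ∣ + ∣ q ∣
∣p∪q∣+∣p∩q∣≡∣p∣+∣q∣ [] [] = refl
∣p∪q∣+∣p∩q∣≡∣p∣+∣q∣ (inside ∷ p) (inside ∷ q) =
  cong suc (trans (+-suc _ _) (trans (cong suc (∣p∪q∣+∣p∩q∣≡∣p∣+∣q∣ p q)) (sym (+-suc _ _))))
∣p∪q∣+∣p∩q∣≡∣p∣+∣q∣ (inside ∷ p) (outside ∷ q) = cong suc (∣p∪q∣+∣p∩q∣≡∣p∣+∣q∣ p q)
∣p∪q∣+∣p∩q∣≡∣p∣+∣q∣ (outside ∷ p) (inside ∷ q) = trans (cong suc (∣p∪q∣+∣p∩q∣≡∣p∣+∣q∣ p q)) (sym (+-suc _ _))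
∣p∪q∣+∣p∩q∣≡∣p∣+∣q∣ (outside ∷ p) (outside ∷ q) = ∣p∪q∣+∣p∩q∣≡∣p∣+∣q∣ p q

x∈p⇒0<∣p∣ : ∀ {n} {p : Subset n} {x} → x ∈ p → 0 < ∣ p ∣
x∈p⇒0<∣p∣ {p = p} {x} x∈p =
  subst (_≤ ∣ p ∣) (∣⁅x⁆∣≡1 x) (p⊆q⇒∣p∣≤∣q∣ (λ y∈⁅x⁆ → subst (_∈ p) (sym (x∈⁅y⁆⇒x≡y x y∈⁅x⁆)) x∈p))

∩≡⊥⇒∉ : ∀ {n} {p q : Subset n} {x} → p ∩ q ≡ ⊥ → x ∈ p → x ∉ q
∩≡⊥⇒∉ {x = x} p∩q≡⊥ x∈p x∈q = ∉⊥ (subst (x ∈_) p∩q≡⊥ (x∈p∩q⁺ (x∈p , x∈q)))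

module Relabel {n : ℕ} (π : Fin n → Fin n) (π-involutive : ∀ z → π (π z) ≡ z) where

  relabel : Subset n → Subset n
  relabel F = tabulate (lookup F ∘ π)

  relabel-involutive : ∀ F → relabel (relabel F) ≡ F
  relabel-involutive F =
    trans (tabulate-cong (λ z → trans (lookup∘tabulate _ (π z)) (cong (lookup F) (π-involutive z))))
          (tabulate∘lookup F)

  ∈-relabel⁺ : ∀ {F z} → π z ∈ F → z ∈ relabel F
  ∈-relabel⁺ {F} {z} πz∈F = lookup⇒[]= z (relabel F) (trans (lookup∘tabulate _ z) ([]=⇒lookup πz∈F))

  ∈-relabel⁻ : ∀ {F z} → z ∈ relabel F → π z ∈ F
  ∈-relabel⁻ {F} {z} z∈σF = lookup⇒[]= (π z) F (trans (sym (lookup∘tabulate _ z)) ([]=⇒lookup z∈σF))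

  ∣relabel∣ : ∀ F → ∣ relabel F ∣ ≡ ∣ F ∣
  ∣relabel∣ F = begin
    ∣ relabel F ∣                              ≡⟨ ∣p∣≡countᵇ-lookup (relabel F) ⟩
    countᵇ (lookup (relabel F)) (allFin n)     ≡⟨ countᵇ-cong (lookup∘tabulate _) (allFin n) ⟩
    countᵇ (lookup F ∘ π) (allFin n)           ≡⟨ countᵇ-involution (Unique.allFin⁺ n) ∈-allFin π-involutive (lookup F) ⟩
    countᵇ (lookup F) (allFin n)               ≡⟨ ∣p∣≡countᵇ-lookup F ⟨
    ∣ F ∣                                      ∎
    where open ≡-Reasoning

  inStarᵇ-relabel : ∀ {P Q : Subset n} → (∀ {z} → z ∈ P → π z ∈ Q) → (∀ {z} → z ∈ Q → π z ∈ P) →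
    ∀ k F → inStarᵇ k P (relabel F) ≡ inStarᵇ k Q F
  inStarᵇ-relabel {P} {Q} P→Q Q→P k F =
    cong₂ _∧_ (cong (_≡ᵇ k) (∣relabel∣ F)) (does-⇔ (mk⇔ to from) (P ⊆? relabel F) (Q ⊆? F))
    where
    to : P ⊆ relabel F → Q ⊆ F
    to P⊆ {z} z∈Q = subst (_∈ F) (π-involutive z) (∈-relabel⁻ (P⊆ (Q→P z∈Q)))
    from : Q ⊆ F → P ⊆ relabel F
    from Q⊆ z∈P = ∈-relabel⁺ (Q⊆ (P→Q z∈P))

-- Exchanging two sets of points

module _ {A : Set} (_≟_ : DecidableEquality A) where

  open import Data.List.Membership.DecPropositional _≟_ using () renaming (_∈?_ to _∈ˡ?_)

  swap : List A → List A → A → A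
  swap (x ∷ xs) (y ∷ ys) z with z ≟ x
  ... | yes _ = y
  ... | no _ with z ≟ y
  ...   | yes _ = x
  ...   | no _  = swap xs ys z
  swap _ _ z = z

  private
    Disjoint-tail : ∀ {x y : A} {xs ys} → Disjoint (x ∷ xs) (y ∷ ys) → Disjoint xs ys
    Disjoint-tail d (z∈xs , z∈ys) = d (there z∈xs , there z∈ys)

  swap-head : ∀ x y xs ys → swap (x ∷ xs) (y ∷ ys) x ≡ y
  swap-head x y xs ys with x ≟ x
  ... | yes _  = refl
  ... | no x≢x = ⊥-elim (x≢x refl)

  swap-head′ : ∀ {x y} xs ys → y ≢ x → swap (x ∷ xs) (y ∷ ys) y ≡ x
  swap-head′ {x} {y} xs ys y≢x with y ≟ x
  ... | yes y≡x = ⊥-elim (y≢x y≡x)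
  ... | no _ with y ≟ y
  ...   | yes _  = refl
  ...   | no y≢y = ⊥-elim (y≢y refl)

  swap-tail : ∀ {x y z} xs ys → z ≢ x → z ≢ y → swap (x ∷ xs) (y ∷ ys) z ≡ swap xs ys z
  swap-tail {x} {y} {z} xs ys z≢x z≢y with z ≟ x
  ... | yes z≡x = ⊥-elim (z≢x z≡x)
  ... | no _ with z ≟ y
  ...   | yes z≡y = ⊥-elim (z≢y z≡y)
  ...   | no _    = refl

  swap-fixes : ∀ xs ys {z} → z ∉ˡ xs → z ∉ˡ ys → swap xs ys z ≡ z
  swap-fixes [] ys _ _ = refl
  swap-fixes (x ∷ xs) [] _ _ = refl
  swap-fixes (x ∷ xs) (y ∷ ys) z∉x∷xs z∉y∷ys =
    trans (swap-tail xs ys (z∉x∷xs ∘ here) (z∉y∷ys ∘ here)) (swap-fixes xs ys (z∉x∷xs ∘ there) (z∉y∷ys ∘ there))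

  swap-∈ˡ : ∀ {xs ys z} → length xs ≡ length ys → Disjoint xs ys → z ∈ˡ xs → swap xs ys z ∈ˡ ys
  swap-∈ˡ {x ∷ xs} {y ∷ ys} {z} len d z∈ with z ≟ x
  ... | yes _ = here refl
  ... | no z≢x with z ≟ y
  ...   | yes refl = ⊥-elim (d (z∈ , here refl))
  ...   | no _ with z∈
  ...     | here z≡x   = ⊥-elim (z≢x z≡x)
  ...     | there z∈xs = there (swap-∈ˡ (cong pred len) (Disjoint-tail d) z∈xs)

  swap-∈ʳ : ∀ {xs ys z} → length xs ≡ length ys → Disjoint xs ys → z ∈ˡ ys → swap xs ys z ∈ˡ xs
  swap-∈ʳ {x ∷ xs} {y ∷ ys} {z} len d z∈ with z ≟ x
  ... | yes refl = ⊥-elim (d (here refl , z∈))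
  ... | no _ with z ≟ y
  ...   | yes _ = here refl
  ...   | no z≢y with z∈
  ...     | here z≡y   = ⊥-elim (z≢y z≡y)
  ...     | there z∈ys = there (swap-∈ʳ (cong pred len) (Disjoint-tail d) z∈ys)

  swap-≢ : ∀ {xs ys z w} → length xs ≡ length ys → Disjoint xs ys →
    w ∉ˡ xs → w ∉ˡ ys → z ≢ w → swap xs ys z ≢ w
  swap-≢ {xs} {ys} {z} len d w∉xs w∉ys z≢w e with z ∈ˡ? xs | z ∈ˡ? ys
  ... | yes z∈xs | _        = w∉ys (subst (_∈ˡ ys) e (swap-∈ˡ len d z∈xs))
  ... | no _     | yes z∈ys = w∉xs (subst (_∈ˡ xs) e (swap-∈ʳ len d z∈ys))
  ... | no z∉xs  | no z∉ys  = z≢w (trans (sym (swap-fixes xs ys z∉xs z∉ys)) e)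

  swap-involutive : ∀ {xs ys} → length xs ≡ length ys → Disjoint xs ys → Unique xs → Unique ys →
    ∀ z → swap xs ys (swap xs ys z) ≡ z
  swap-involutive {[]}     _ _ _ _ z = refl
  swap-involutive {x ∷ xs} {[]} _ _ _ _ z = refl
  swap-involutive {x ∷ xs} {y ∷ ys} len d xs! ys! z = by-cases (z ≟ x) (z ≟ y)
    where
    S = swap (x ∷ xs) (y ∷ ys)
    d′ = Disjoint-tail d
    y≢x : y ≢ x
    y≢x refl = d (here refl , here refl)

    tail : ∀ {a as} → Unique (a ∷ as) → Unique as
    tail (_ ∷ as!) = as!

    by-cases : Dec (z ≡ x) → Dec (z ≡ y) → S (S z) ≡ z
    by-cases (yes z≡x) _ =
      trans (cong (S ∘ S) z≡x) (trans (cong S (swap-head x y xs ys)) (trans (swap-head′ xs ys y≢x) (sym z≡x)))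
    by-cases (no _) (yes z≡y) =
      trans (cong (S ∘ S) z≡y) (trans (cong S (swap-head′ xs ys y≢x)) (trans (swap-head x y xs ys) (sym z≡y)))
    by-cases (no z≢x) (no z≢y) = begin
      S (S z)        ≡⟨ cong S (swap-tail xs ys z≢x z≢y) ⟩
      S w            ≡⟨ swap-tail xs ys w≢x w≢y ⟩
      swap xs ys w   ≡⟨ swap-involutive (cong pred len) d′ (tail xs!) (tail ys!) z ⟩
      z              ∎
      where
      open ≡-Reasoning
      w = swap xs ys z
      w≢x : w ≢ x
      w≢x = swap-≢ (cong pred len) d′ (Unique.Unique[x∷xs]⇒x∉xs xs!) (λ x∈ys → d (here refl , there x∈ys)) z≢x
      w≢y : w ≢ y
      w≢y = swap-≢ (cong pred len) d′ (λ y∈xs → d (there y∈xs , here refl)) (Unique.Unique[x∷xs]⇒x∉xs ys!) z≢y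

module Exchange {n : ℕ} (P Q : Subset n) (∣P∣≡∣Q∣ : ∣ P ∣ ≡ ∣ Q ∣) where

  private
    onlyIn : Subset n → Subset n → List (Fin n)
    onlyIn p q = filterᵇ (λ z → not (lookup q z) ∧ lookup p z) (allFin n)

    ∈-onlyIn⁺ : ∀ p q {z} → z ∈ p → z ∉ q → z ∈ˡ onlyIn p q
    ∈-onlyIn⁺ p q {z} z∈p z∉q =
      ∈-filterᵇ⁺ (λ z → not (lookup q z) ∧ lookup p z) (∈-allFin z) (cong₂ (λ b a → not b ∧ a) (lookup-∉ z∉q) ([]=⇒lookup z∈p))

    ∈-onlyIn⁻ : ∀ p q {z} → z ∈ˡ onlyIn p q → z ∈ p × z ∉ q
    ∈-onlyIn⁻ p q {z} z∈ with lookup q z in eq | lookup p z in ep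
                            | proj₂ (∈-filterᵇ⁻ (λ z → not (lookup q z) ∧ lookup p z) {allFin n} z∈)
    ... | false | true | _ = lookup⇒[]= z p ep , λ z∈q → true≢false (trans (sym ([]=⇒lookup z∈q)) eq)
      where true≢false : true ≢ false
            true≢false ()

    length-onlyIn : length (onlyIn P Q) ≡ length (onlyIn Q P)
    length-onlyIn = +-cancelˡ-≡ (countᵇ (λ z → lookup Q z ∧ lookup P z) (allFin n)) _ _ (begin
      countᵇ (λ z → lookup Q z ∧ lookup P z) (allFin n) + length (onlyIn P Q)
        ≡⟨ countᵇ-split (lookup Q) (lookup P) (allFin n) ⟨
      countᵇ (lookup P) (allFin n)   ≡⟨ ∣p∣≡countᵇ-lookup P ⟨
      ∣ P ∣                          ≡⟨ ∣P∣≡∣Q∣ ⟩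
      ∣ Q ∣                          ≡⟨ ∣p∣≡countᵇ-lookup Q ⟩
      countᵇ (lookup Q) (allFin n)   ≡⟨ countᵇ-split (lookup P) (lookup Q) (allFin n) ⟩
      countᵇ (λ z → lookup P z ∧ lookup Q z) (allFin n) + length (onlyIn Q P)
        ≡⟨ cong (_+ length (onlyIn Q P)) (countᵇ-cong (λ z → ∧-comm (lookup P z) (lookup Q z)) (allFin n)) ⟩
      countᵇ (λ z → lookup Q z ∧ lookup P z) (allFin n) + length (onlyIn Q P) ∎)
      where open ≡-Reasoning

    onlyIn-disjoint : Disjoint (onlyIn P Q) (onlyIn Q P)
    onlyIn-disjoint (z∈PQ , z∈QP) = proj₂ (∈-onlyIn⁻ Q P z∈QP) (proj₁ (∈-onlyIn⁻ P Q z∈PQ))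

    onlyIn-unique : ∀ p q → Unique (onlyIn p q)
    onlyIn-unique p q = filterᵇ-unique _ (Unique.allFin⁺ n)

  exchange : Fin n → Fin n
  exchange = swap Fin._≟_ (onlyIn P Q) (onlyIn Q P)

  exchange-involutive : ∀ z → exchange (exchange z) ≡ z
  exchange-involutive = swap-involutive Fin._≟_ length-onlyIn onlyIn-disjoint (onlyIn-unique P Q) (onlyIn-unique Q P)

  exchange-fixes : ∀ {z} → z ∉ P → z ∉ Q → exchange z ≡ z
  exchange-fixes z∉P z∉Q = swap-fixes Fin._≟_ _ _ (z∉P ∘ proj₁ ∘ ∈-onlyIn⁻ P Q) (z∉Q ∘ proj₁ ∘ ∈-onlyIn⁻ Q P)

  private
    exchange-fixes′ : ∀ {z} → z ∈ P → z ∈ Q → exchange z ≡ z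
    exchange-fixes′ z∈P z∈Q =
      swap-fixes Fin._≟_ _ _ (λ z∈ → proj₂ (∈-onlyIn⁻ P Q z∈) z∈Q) (λ z∈ → proj₂ (∈-onlyIn⁻ Q P z∈) z∈P)

  exchange-∈ˡ : ∀ {z} → z ∈ P → exchange z ∈ Q
  exchange-∈ˡ {z} z∈P with z ∈? Q
  ... | yes z∈Q = subst (_∈ Q) (sym (exchange-fixes′ z∈P z∈Q)) z∈Q
  ... | no z∉Q  = proj₁ (∈-onlyIn⁻ Q P (swap-∈ˡ Fin._≟_ length-onlyIn onlyIn-disjoint (∈-onlyIn⁺ P Q z∈P z∉Q)))

  exchange-∈ʳ : ∀ {z} → z ∈ Q → exchange z ∈ P
  exchange-∈ʳ {z} z∈Q with z ∈? P
  ... | yes z∈P = subst (_∈ P) (sym (exchange-fixes′ z∈P z∈Q)) z∈P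
  ... | no z∉P  = proj₁ (∈-onlyIn⁻ P Q (swap-∈ʳ Fin._≟_ length-onlyIn onlyIn-disjoint (∈-onlyIn⁺ Q P z∈Q z∉P)))

≡ᵇ-true⇒≡ : ∀ m n → (m ≡ᵇ n) ≡ true → m ≡ n
≡ᵇ-true⇒≡ m n e = ≡ᵇ⇒≡ m n (subst Data.Bool.T (sym e) tt)

≡ᵇ-false⇒≢ : ∀ m n → (m ≡ᵇ n) ≡ false → m ≢ n
≡ᵇ-false⇒≢ m _ e refl = subst Data.Bool.T e (≡⇒≡ᵇ m m refl)

m<n⇒m≤n∸1 : ∀ {m n} → m < n → m ≤ n ∸ 1
m<n⇒m≤n∸1 (s≤s m≤n) = m≤n

m≤n∸1⇒m<n : ∀ {m n} → 0 < n → m ≤ n ∸ 1 → m < n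
m≤n∸1⇒m<n {n = suc n} _ m≤n = s≤s m≤n

∈-range⁺ : ∀ {m i} → 1 ≤ i → i ≤ m → i ∈ˡ range 1 m
∈-range⁺ {i = suc i} _ i≤m = ∈-map⁺ suc (∈-upTo⁺ i≤m)

∈-range⁻ : ∀ {m i} → i ∈ˡ range 1 m → 1 ≤ i × i ≤ m
∈-range⁻ i∈ with ∈-map⁻ suc i∈
... | _ , j∈ , refl = s≤s z≤n , ∈-upTo⁻ j∈

≤2t∸[k+1]⇒k+m<t+t : ∀ {m} k t → 2 * t ∸ (k + 1) ≢ 0 → m ≤ 2 * t ∸ (k + 1) → k + m < t + t
≤2t∸[k+1]⇒k+m<t+t {m} k t d≢0 m≤d =
  subst₂ _≤_ (shuffle m k) (double t) (m≤o∸n⇒m+n≤o m (<⇒≤ (m∸n≢0⇒n<m d≢0)) m≤d)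
  where
  shuffle : ∀ m k → m + (k + 1) ≡ suc (k + m)
  shuffle = solve-∀
  double : ∀ t → 2 * t ≡ t + t
  double = solve-∀

[4+m]*[m⊔1]≤[2+m]*[2+m] : ∀ m → (4 + m) * (m ⊔ 1) ≤ (2 + m) * (2 + m)
[4+m]*[m⊔1]≤[2+m]*[2+m] zero    = ≤-refl
[4+m]*[m⊔1]≤[2+m]*[2+m] (suc m) = subst₂ _≤_ (cong ((5 + m) *_) (cong suc (sym (⊔-identityʳ m))))
  (expand m) (m≤m+n ((5 + m) * (1 + m)) 4)
  where
  expand : ∀ m → (5 + m) * (1 + m) + 4 ≡ (3 + m) * (3 + m)
  expand = solve-∀

splitting-gain : ∀ a b m → a ∨ b ≡ true →
  (((if a then 4 else 0) + m) ⊔ 1) * (((if b then 4 else 0) + m) ⊔ 1)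
    ≤ ((if a then 2 else 0) + ((if b then 2 else 0) + m)) * ((if b then 2 else 0) + ((if a then 2 else 0) + m))
splitting-gain true  true  m _ = ≤-refl
splitting-gain true  false m _ = [4+m]*[m⊔1]≤[2+m]*[2+m] m
splitting-gain false true  m _ = subst (_≤ (2 + m) * (2 + m)) (*-comm (4 + m) (m ⊔ 1)) ([4+m]*[m⊔1]≤[2+m]*[2+m] m)

inStarᵇ⁻ : ∀ {n} k (P F : Subset n) → inStarᵇ k P F ≡ true → ∣ F ∣ ≡ k × P ⊆ F
inStarᵇ⁻ k P F e with ∣ F ∣ ≡ᵇ k in size | P ⊆? F
... | true | yes P⊆F = ≡ᵇ-true⇒≡ ∣ F ∣ k size , P⊆F

stars-disjoint : ∀ {n t} k (P Q F : Subset n) → ∣ P ∣ ≡ t → ∣ Q ∣ ≡ t → k + ∣ P ∩ Q ∣ < t + t →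
  ¬ (inStarᵇ k P F ≡ true × inStarᵇ k Q F ≡ true)
stars-disjoint {t = t} k P Q F ∣P∣≡t ∣Q∣≡t small (F∈P , F∈Q) = <-irrefl refl (begin-strict
  t + t                       ≡⟨ sym (cong₂ _+_ ∣P∣≡t ∣Q∣≡t) ⟩
  ∣ P ∣ + ∣ Q ∣               ≡⟨ ∣p∪q∣+∣p∩q∣≡∣p∣+∣q∣ P Q ⟨
  ∣ P ∪ Q ∣ + ∣ P ∩ Q ∣       ≤⟨ +-monoˡ-≤ ∣ P ∩ Q ∣ ∣P∪Q∣≤k ⟩
  k + ∣ P ∩ Q ∣               <⟨ small ⟩
  t + t                       ∎)
  where
  open ≤-Reasoning
  ∣P∪Q∣≤k : ∣ P ∪ Q ∣ ≤ k
  ∣P∪Q∣≤k = let (∣F∣≡k , P⊆F) = inStarᵇ⁻ k P F F∈P ; (_ , Q⊆F) = inStarᵇ⁻ k Q F F∈Q in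
    subst (∣ P ∪ Q ∣ ≤_) ∣F∣≡k (p⊆q⇒∣p∣≤∣q∣ (λ z∈ → [ P⊆F , Q⊆F ] (x∈p∪q⁻ P Q z∈)))

inUnionᵇ⁺ : ∀ {n} k (T : ℕ → Subset n) {idx j F} → j ∈ˡ idx → inStarᵇ k (T j) F ≡ true → inUnionᵇ k T idx F ≡ true
inUnionᵇ⁺ k T {F = F} = any-true⁺ (λ i → inStarᵇ k (T i) F)

allowedᵇ-owner : ∀ {n r} k (T : ℕ → Subset n) (C : ℕ → Subset r) idx F {c j} →
  j ∈ˡ idx → c ∈ C j → (∀ {i} → i ∈ˡ idx → c ∈ C i → i ≡ j) → allowedᵇ k T C idx F c ≡ inStarᵇ k (T j) F
allowedᵇ-owner k T C idx F {c} j∈ c∈Cj unique =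
  any-∧-unique (λ i → inStarᵇ k (T i) F) (λ i → does (c ∈? C i)) idx j∈ (dec-true (c ∈? C _) c∈Cj)
    (λ {i} i∈ → unique i∈ ∘ does-true⇒ (c ∈? C i))

-- Splitting a part of the colour partition

module SplitPart
  {n r : ℕ} (k t s : ℕ) (2≤s : 2 ≤ s) (T : ℕ → Subset n)
  (∣T∣≡t : ∀ i → 1 ≤ i → i ≤ s → ∣ T i ∣ ≡ t)
  (∣T∩T∣≤ : ∀ i j → 1 ≤ i → i < j → j ≤ s → ∣ T i ∩ T j ∣ ≤ 2 * t ∸ (k + 1))
  (C : ℕ → Subset r)
  (C-disjoint : ∀ i j → 1 ≤ i → i ≤ s ∸ 1 → 1 ≤ j → j ≤ s ∸ 1 → i ≢ j → C i ∩ C j ≡ ⊥)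
  (C-cover : ∀ (c : Fin r) → Σ ℕ (λ i → 1 ≤ i × i ≤ s ∸ 1 × c ∈ C i))
  (∣C₁∣≡4 : ∣ C 1 ∣ ≡ 4)
  (A B : Subset r) (A∩B≡⊥ : A ∩ B ≡ ⊥) (A∪B≡C₁ : A ∪ B ≡ C 1) (∣A∣≡2 : ∣ A ∣ ≡ 2) (∣B∣≡2 : ∣ B ∣ ≡ 2)
  where

  C′ : ℕ → Subset r
  C′ = modParts s C A B

  before after : List ℕ
  before = range 1 (s ∸ 1)
  after  = range 1 s

  star : ℕ → Subset n → Bool
  star i = inStarᵇ k (T i)

  u v : Subset n → Bool
  u = star 1
  v = star s

  1∈before : 1 ∈ˡ before
  1∈before = ∈-range⁺ ≤-refl (m<n⇒m≤n∸1 2≤s)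

  1∈after : 1 ∈ˡ after
  1∈after = ∈-range⁺ ≤-refl (<⇒≤ 2≤s)

  s∈after : s ∈ˡ after
  s∈after = ∈-range⁺ (<⇒≤ 2≤s) ≤-refl

  owner : Fin r → ℕ
  owner c = proj₁ (C-cover c)

  1≤owner : ∀ c → 1 ≤ owner c
  1≤owner c = proj₁ (proj₂ (C-cover c))

  owner≤s∸1 : ∀ c → owner c ≤ s ∸ 1
  owner≤s∸1 c = proj₁ (proj₂ (proj₂ (C-cover c)))

  owner<s : ∀ c → owner c < s
  owner<s c = m≤n∸1⇒m<n (<⇒≤ 2≤s) (owner≤s∸1 c)

  ∈-owner : ∀ c → c ∈ C (owner c)
  ∈-owner c = proj₂ (proj₂ (proj₂ (C-cover c)))

  owner∈before : ∀ c → owner c ∈ˡ before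
  owner∈before c = ∈-range⁺ (1≤owner c) (owner≤s∸1 c)

  owner-unique : ∀ {c i} → i ∈ˡ before → c ∈ C i → i ≡ owner c
  owner-unique {c} {i} i∈ c∈Cᵢ with i ≟ℕ owner c
  ... | yes i≡owner = i≡owner
  ... | no  i≢owner = let (1≤i , i≤s∸1) = ∈-range⁻ i∈ in
    ⊥-elim (∩≡⊥⇒∉ (C-disjoint i (owner c) 1≤i i≤s∸1 (1≤owner c) (owner≤s∸1 c) i≢owner) c∈Cᵢ (∈-owner c))

  owner-outside-C₁ : ∀ {c} → c ∉ C 1 → 2 ≤ owner c
  owner-outside-C₁ {c} c∉C₁ =
    ≤∧≢⇒< (1≤owner c) (λ 1≡owner → c∉C₁ (subst (λ i → c ∈ C i) (sym 1≡owner) (∈-owner c)))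

  A⊆C₁ : A ⊆ C 1
  A⊆C₁ {c} c∈A = subst (c ∈_) A∪B≡C₁ (x∈p∪q⁺ (inj₁ c∈A))

  B⊆C₁ : B ⊆ C 1
  B⊆C₁ {c} c∈B = subst (c ∈_) A∪B≡C₁ (x∈p∪q⁺ (inj₂ c∈B))

  C₁⊆A∪B : ∀ {c} → c ∈ C 1 → c ∈ A ⊎ c ∈ B
  C₁⊆A∪B {c} c∈C₁ = x∈p∪q⁻ A B (subst (c ∈_) (sym A∪B≡C₁) c∈C₁)

  C′-index : ∀ {c i} → i ∈ˡ after → c ∈ C′ i →
    (c ∈ A × i ≡ 1) ⊎ (c ∈ B × i ≡ s) ⊎ (c ∉ A × c ∉ B × i ≡ owner c)
  C′-index {c} {i} i∈ c∈C′i with i ≡ᵇ 1 in i≡ᵇ1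
  ... | true  = inj₁ (c∈C′i , ≡ᵇ-true⇒≡ i 1 i≡ᵇ1)
  ... | false with i ≡ᵇ s in i≡ᵇs
  ...   | true  = inj₂ (inj₁ (c∈C′i , ≡ᵇ-true⇒≡ i s i≡ᵇs))
  ...   | false = inj₂ (inj₂ (c∉A , c∉B , owner-unique i∈before c∈C′i))
    where
    i∈before : i ∈ˡ before
    i∈before = ∈-range⁺ (proj₁ (∈-range⁻ i∈))
      (m<n⇒m≤n∸1 (≤∧≢⇒< (proj₂ (∈-range⁻ i∈)) (≡ᵇ-false⇒≢ i s i≡ᵇs)))
    C₁∩Cᵢ-empty : ∀ {c} → c ∈ C 1 → c ∉ C i
    C₁∩Cᵢ-empty c∈C₁ c∈Cᵢ = ≡ᵇ-false⇒≢ i 1 i≡ᵇ1 (trans (owner-unique i∈before c∈Cᵢ) (sym (owner-unique 1∈before c∈C₁)))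
    c∉A : c ∉ A
    c∉A c∈A = C₁∩Cᵢ-empty (A⊆C₁ c∈A) c∈C′i
    c∉B : c ∉ B
    c∉B c∈B = C₁∩Cᵢ-empty (B⊆C₁ c∈B) c∈C′i

  C′s≡B : C′ s ≡ B
  C′s≡B with s ≡ᵇ 1 in s≡ᵇ1
  ... | true  = ⊥-elim (<-irrefl (sym (≡ᵇ-true⇒≡ s 1 s≡ᵇ1)) 2≤s)
  ... | false with s ≡ᵇ s in s≡ᵇs
  ...   | true  = refl
  ...   | false = ⊥-elim (≡ᵇ-false⇒≢ s s s≡ᵇs refl)

  C′-middle : ∀ {i} → i ≢ 1 → i ≢ s → C′ i ≡ C i
  C′-middle {i} i≢1 i≢s with i ≡ᵇ 1 in i≡ᵇ1
  ... | true  = ⊥-elim (i≢1 (≡ᵇ-true⇒≡ i 1 i≡ᵇ1))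
  ... | false with i ≡ᵇ s in i≡ᵇs
  ...   | true  = ⊥-elim (i≢s (≡ᵇ-true⇒≡ i s i≡ᵇs))
  ...   | false = refl

  allowed-before : ∀ F c → allowedᵇ k T C before F c ≡ star (owner c) F
  allowed-before F c = allowedᵇ-owner k T C before F (owner∈before c) (∈-owner c) owner-unique

  allowed-before-C₁ : ∀ F {c} → c ∈ C 1 → allowedᵇ k T C before F c ≡ u F
  allowed-before-C₁ F c∈C₁ = trans (allowed-before F _) (cong (λ i → star i F) (sym (owner-unique 1∈before c∈C₁)))

  allowed-after-A : ∀ F {c} → c ∈ A → allowedᵇ k T C′ after F c ≡ u F
  allowed-after-A F {c} c∈A = allowedᵇ-owner k T C′ after F 1∈after c∈A unique
    where
    unique : ∀ {i} → i ∈ˡ after → c ∈ C′ i → i ≡ 1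
    unique i∈ c∈C′i with C′-index i∈ c∈C′i
    ... | inj₁ (_ , i≡1)           = i≡1
    ... | inj₂ (inj₁ (c∈B , _))    = ⊥-elim (∩≡⊥⇒∉ A∩B≡⊥ c∈A c∈B)
    ... | inj₂ (inj₂ (c∉A , _))    = ⊥-elim (c∉A c∈A)

  allowed-after-B : ∀ F {c} → c ∈ B → allowedᵇ k T C′ after F c ≡ v F
  allowed-after-B F {c} c∈B = allowedᵇ-owner k T C′ after F s∈after (subst (c ∈_) (sym C′s≡B) c∈B) unique
    where
    unique : ∀ {i} → i ∈ˡ after → c ∈ C′ i → i ≡ s
    unique i∈ c∈C′i with C′-index i∈ c∈C′i
    ... | inj₁ (c∈A , _)           = ⊥-elim (∩≡⊥⇒∉ A∩B≡⊥ c∈A c∈B)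
    ... | inj₂ (inj₁ (_ , i≡s))    = i≡s
    ... | inj₂ (inj₂ (_ , c∉B , _)) = ⊥-elim (c∉B c∈B)

  allowed-after-rest : ∀ F {c} → c ∉ A → c ∉ B → allowedᵇ k T C′ after F c ≡ star (owner c) F
  allowed-after-rest F {c} c∉A c∉B = allowedᵇ-owner k T C′ after F owner∈after c∈C′owner unique
    where
    owner∈after = ∈-range⁺ (1≤owner c) (<⇒≤ (owner<s c))
    c∈C′owner : c ∈ C′ (owner c)
    c∈C′owner = subst (c ∈_) (sym (C′-middle owner≢1 owner≢s)) (∈-owner c)
      where
      owner≢1 : owner c ≢ 1
      owner≢1 owner≡1 = [ c∉A , c∉B ] (C₁⊆A∪B (subst (λ i → c ∈ C i) owner≡1 (∈-owner c)))
      owner≢s : owner c ≢ s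
      owner≢s owner≡s = <-irrefl owner≡s (owner<s c)
    unique : ∀ {i} → i ∈ˡ after → c ∈ C′ i → i ≡ owner c
    unique i∈ c∈C′i with C′-index i∈ c∈C′i
    ... | inj₁ (c∈A , _)               = ⊥-elim (c∉A c∈A)
    ... | inj₂ (inj₁ (c∈B , _))        = ⊥-elim (c∉B c∈B)
    ... | inj₂ (inj₂ (_ , _ , i≡owner)) = i≡owner

  rest : Subset n → ℕ
  rest F = countᵇ (λ c → not (does (c ∈? C 1)) ∧ star (owner c) F) (allFin r)

  count-before : ∀ F → countᵇ (allowedᵇ k T C before F) (allFin r) ≡ (if u F then 4 else 0) + rest F
  count-before F = begin
    countᵇ (allowedᵇ k T C before F) (allFin r)
      ≡⟨ countᵇ-cong (allowed-before F) (allFin r) ⟩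
    countᵇ (λ c → star (owner c) F) (allFin r)
      ≡⟨ countᵇ-split (λ c → does (c ∈? C 1)) _ (allFin r) ⟩
    countᵇ (λ c → does (c ∈? C 1) ∧ star (owner c) F) (allFin r) + rest F
      ≡⟨ cong (_+ rest F) (countᵇ-cong on-C₁ (allFin r)) ⟩
    countᵇ (λ c → does (c ∈? C 1) ∧ u F) (allFin r) + rest F
      ≡⟨ cong (_+ rest F) (countᵇ-∈?-∧ (C 1) ∣C₁∣≡4 (u F)) ⟩
    (if u F then 4 else 0) + rest F ∎
    where
    open ≡-Reasoning
    on-C₁ : ∀ c → does (c ∈? C 1) ∧ star (owner c) F ≡ does (c ∈? C 1) ∧ u F
    on-C₁ c with c ∈? C 1
    ... | yes c∈C₁ = cong (λ i → star i F) (sym (owner-unique 1∈before c∈C₁))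
    ... | no _     = refl

  count-after : ∀ F → countᵇ (allowedᵇ k T C′ after F) (allFin r)
                    ≡ (if u F then 2 else 0) + ((if v F then 2 else 0) + rest F)
  count-after F = begin
    countᵇ a (allFin r)
      ≡⟨ countᵇ-split (λ c → does (c ∈? A)) a (allFin r) ⟩
    countᵇ (λ c → does (c ∈? A) ∧ a c) (allFin r) + countᵇ (λ c → not (does (c ∈? A)) ∧ a c) (allFin r)
      ≡⟨ cong₂ _+_ (countᵇ-cong on-A (allFin r)) (countᵇ-split (λ c → does (c ∈? B)) _ (allFin r)) ⟩
    countᵇ (λ c → does (c ∈? A) ∧ u F) (allFin r)
      + (countᵇ (λ c → does (c ∈? B) ∧ (not (does (c ∈? A)) ∧ a c)) (allFin r)
         + countᵇ (λ c → not (does (c ∈? B)) ∧ (not (does (c ∈? A)) ∧ a c)) (allFin r))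
      ≡⟨ cong₂ _+_ (countᵇ-∈?-∧ A ∣A∣≡2 (u F))
                   (cong₂ _+_ (trans (countᵇ-cong on-B (allFin r)) (countᵇ-∈?-∧ B ∣B∣≡2 (v F)))
                              (countᵇ-cong off-C₁ (allFin r))) ⟩
    (if u F then 2 else 0) + ((if v F then 2 else 0) + rest F) ∎
    where
    open ≡-Reasoning
    a = allowedᵇ k T C′ after F
    on-A : ∀ c → does (c ∈? A) ∧ a c ≡ does (c ∈? A) ∧ u F
    on-A c with c ∈? A
    ... | yes c∈A = allowed-after-A F c∈A
    ... | no _    = refl
    on-B : ∀ c → does (c ∈? B) ∧ (not (does (c ∈? A)) ∧ a c) ≡ does (c ∈? B) ∧ v F
    on-B c with c ∈? B | c ∈? A
    ... | yes c∈B | yes c∈A = ⊥-elim (∩≡⊥⇒∉ A∩B≡⊥ c∈A c∈B)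
    ... | yes c∈B | no _    = allowed-after-B F c∈B
    ... | no _    | _       = refl
    off-C₁ : ∀ c → not (does (c ∈? B)) ∧ (not (does (c ∈? A)) ∧ a c) ≡ not (does (c ∈? C 1)) ∧ star (owner c) F
    off-C₁ c with c ∈? B | c ∈? A | c ∈? C 1
    ... | yes _   | _       | yes _   = refl
    ... | no _    | yes _   | yes _   = refl
    ... | no c∉B  | no c∉A  | no _    = allowed-after-rest F c∉A c∉B
    ... | yes c∈B | _       | no c∉C₁ = ⊥-elim (c∉C₁ (B⊆C₁ c∈B))
    ... | no _    | yes c∈A | no c∉C₁ = ⊥-elim (c∉C₁ (A⊆C₁ c∈A))
    ... | no c∉B  | no c∉A  | yes c∈C₁ = ⊥-elim ([ c∉A , c∉B ] (C₁⊆A∪B c∈C₁))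

  choicesL choicesR : Subset n → ℕ
  choicesL = choices k T C before
  choicesR = choices k T C′ after

  choicesL-≤ : ∀ F → choicesL F ≤ ((if u F then 4 else 0) + rest F) ⊔ 1
  choicesL-≤ F = subst (λ m → choicesL F ≤ m ⊔ 1) (count-before F) (choices-≤ k T C before F)

  choicesR-≡ : ∀ F → u F ∨ v F ≡ true → choicesR F ≡ (if u F then 2 else 0) + ((if v F then 2 else 0) + rest F)
  choicesR-≡ F uv = trans (choices-inUnion k T C′ after (in-after uv)) (count-after F)
    where
    in-after : u F ∨ v F ≡ true → inUnionᵇ k T after F ≡ true
    in-after uv with u F in uF | v F in vF
    ... | true  | _    = inUnionᵇ⁺ k T 1∈after uF
    ... | false | true = inUnionᵇ⁺ k T s∈after vF

  choices-away : ∀ {F} → u F ≡ false → v F ≡ false → choicesL F ≡ choicesR F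
  choices-away {F} uF vF =
    cong₂ (λ b m → if b then m else 1) (any-cong (λ i → star i F) before after before→after after→before)
                                       (countᵇ-cong same-colours (allFin r))
    where
    before→after : ∀ {i} → i ∈ˡ before → star i F ≡ true → i ∈ˡ after
    before→after i∈ _ = ∈-range⁺ (proj₁ (∈-range⁻ i∈)) (≤-trans (proj₂ (∈-range⁻ i∈)) (m∸n≤m s 1))
    after→before : ∀ {i} → i ∈ˡ after → star i F ≡ true → i ∈ˡ before
    after→before {i} i∈ Fᵢ = ∈-range⁺ (proj₁ (∈-range⁻ i∈)) (m<n⇒m≤n∸1 (≤∧≢⇒< (proj₂ (∈-range⁻ i∈)) i≢s))
      where
      i≢s : i ≢ s
      i≢s refl with () ← trans (sym Fᵢ) vF
    same-colours : ∀ c → allowedᵇ k T C before F c ≡ allowedᵇ k T C′ after F c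
    same-colours c with c ∈? A | c ∈? B
    ... | yes c∈A | _       = trans (allowed-before-C₁ F (A⊆C₁ c∈A)) (sym (allowed-after-A F c∈A))
    ... | no _    | yes c∈B = trans (allowed-before-C₁ F (B⊆C₁ c∈B)) (trans uF (trans (sym vF) (sym (allowed-after-B F c∈B))))
    ... | no c∉A  | no c∉B  = trans (allowed-before F c) (sym (allowed-after-rest F c∉A c∉B))

  ∣T₁∣≡∣Tₛ∣ : ∣ T 1 ∣ ≡ ∣ T s ∣
  ∣T₁∣≡∣Tₛ∣ = trans (∣T∣≡t 1 ≤-refl (<⇒≤ 2≤s)) (sym (∣T∣≡t s (<⇒≤ 2≤s) ≤-refl))

  open Exchange (T 1) (T s) ∣T₁∣≡∣Tₛ∣
  open Relabel exchange exchange-involutive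

  u∘relabel : ∀ F → u (relabel F) ≡ v F
  u∘relabel = inStarᵇ-relabel exchange-∈ˡ exchange-∈ʳ k

  v∘relabel : ∀ F → v (relabel F) ≡ u F
  v∘relabel = inStarᵇ-relabel exchange-∈ʳ exchange-∈ˡ k

  uv∘relabel : ∀ F → u F ∨ v F ≡ true → u (relabel F) ∨ v (relabel F) ≡ true
  uv∘relabel F uv = trans (cong₂ _∨_ (u∘relabel F) (v∘relabel F)) (trans (∨-comm (v F) (u F)) uv)

  module _ (d≡0 : 2 * t ∸ (k + 1) ≡ 0) where

    centres-disjoint : ∀ {i j z} → 1 ≤ i → i < j → j ≤ s → z ∈ T i → z ∉ T j
    centres-disjoint {i} {j} 1≤i i<j j≤s z∈Tᵢ z∈Tⱼ =
      <-irrefl refl (≤-trans (x∈p⇒0<∣p∣ (x∈p∩q⁺ (z∈Tᵢ , z∈Tⱼ))) (≤-trans (∣T∩T∣≤ i j 1≤i i<j j≤s) (≤-reflexive d≡0)))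

    star-middle∘relabel : ∀ {j} → 2 ≤ j → j < s → ∀ F → star j (relabel F) ≡ star j F
    star-middle∘relabel {j} 2≤j j<s = inStarᵇ-relabel fixed fixed k
      where
      fixed : ∀ {z} → z ∈ T j → exchange z ∈ T j
      fixed {z} z∈Tⱼ = subst (_∈ T j) (sym (exchange-fixes
        (λ z∈T₁ → centres-disjoint ≤-refl 2≤j (<⇒≤ j<s) z∈T₁ z∈Tⱼ)
        (λ z∈Tₛ → centres-disjoint (<⇒≤ 2≤j) j<s ≤-refl z∈Tⱼ z∈Tₛ))) z∈Tⱼ

    rest∘relabel-disjoint : ∀ F → rest (relabel F) ≡ rest F
    rest∘relabel-disjoint F = countᵇ-cong same (allFin r)
      where
      same : ∀ c → not (does (c ∈? C 1)) ∧ star (owner c) (relabel F) ≡ not (does (c ∈? C 1)) ∧ star (owner c) F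
      same c with c ∈? C 1
      ... | yes _    = refl
      ... | no c∉C₁ = star-middle∘relabel (owner-outside-C₁ c∉C₁) (owner<s c) F

  module _ (d≢0 : 2 * t ∸ (k + 1) ≢ 0) where

    stars-apart : ∀ {i j} F → 1 ≤ i → i < j → j ≤ s → ¬ (star i F ≡ true × star j F ≡ true)
    stars-apart {i} {j} F 1≤i i<j j≤s = stars-disjoint k (T i) (T j) F (∣T∣≡t i 1≤i (≤-trans (<⇒≤ i<j) j≤s))
      (∣T∣≡t j (≤-trans 1≤i (<⇒≤ i<j)) j≤s) (≤2t∸[k+1]⇒k+m<t+t k t d≢0 (∣T∩T∣≤ i j 1≤i i<j j≤s))

    rest-vanishes : ∀ G → u G ∨ v G ≡ true → rest G ≡ 0
    rest-vanishes G uv = countᵇ-zero off-C₁ (allFin r)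
      where
      middle-star : ∀ {j} → 2 ≤ j → j < s → star j G ≡ false
      middle-star {j} 2≤j j<s with star j G in Gⱼ | u G in uG | v G in vG
      ... | false | _     | _    = refl
      ... | true  | true  | _    = ⊥-elim (stars-apart G ≤-refl 2≤j (<⇒≤ j<s) (uG , Gⱼ))
      ... | true  | false | true = ⊥-elim (stars-apart G (<⇒≤ 2≤j) j<s ≤-refl (Gⱼ , vG))
      off-C₁ : ∀ c → not (does (c ∈? C 1)) ∧ star (owner c) G ≡ false
      off-C₁ c with c ∈? C 1
      ... | yes _    = refl
      ... | no c∉C₁ = middle-star (owner-outside-C₁ c∉C₁) (owner<s c)

  rest∘relabel : ∀ F → u F ∨ v F ≡ true → rest (relabel F) ≡ rest F
  rest∘relabel F uv with 2 * t ∸ (k + 1) ≟ℕ 0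
  ... | yes d≡0 = rest∘relabel-disjoint d≡0 F
  ... | no d≢0  = trans (rest-vanishes d≢0 (relabel F) (uv∘relabel F uv)) (sym (rest-vanishes d≢0 F uv))

  near-stars : ∀ F → u F ∨ v F ≡ true → choicesL F * choicesL (relabel F) ≤ choicesR F * choicesR (relabel F)
  near-stars F uv = begin
    choicesL F * choicesL (relabel F)
      ≤⟨ *-mono-≤ (choicesL-≤ F) (choicesL-≤ (relabel F)) ⟩
    (((if u F then 4 else 0) + rest F) ⊔ 1) * (((if u (relabel F) then 4 else 0) + rest (relabel F)) ⊔ 1)
      ≡⟨ cong₂ (λ b m → (((if u F then 4 else 0) + rest F) ⊔ 1) * (((if b then 4 else 0) + m) ⊔ 1))
               (u∘relabel F) (rest∘relabel F uv) ⟩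
    (((if u F then 4 else 0) + rest F) ⊔ 1) * (((if v F then 4 else 0) + rest F) ⊔ 1)
      ≤⟨ splitting-gain (u F) (v F) (rest F) uv ⟩
    ((if u F then 2 else 0) + ((if v F then 2 else 0) + rest F))
      * ((if v F then 2 else 0) + ((if u F then 2 else 0) + rest F))
      ≡⟨ cong₂ _*_ (choicesR-≡ F uv) choicesR∘relabel ⟨
    choicesR F * choicesR (relabel F) ∎
    where
    open ≤-Reasoning
    choicesR∘relabel : choicesR (relabel F) ≡ (if v F then 2 else 0) + ((if u F then 2 else 0) + rest F)
    choicesR∘relabel = trans (choicesR-≡ (relabel F) (uv∘relabel F uv))
      (trans (cong₂ (λ a b → (if a then 2 else 0) + ((if b then 2 else 0) + rest (relabel F)))
                    (u∘relabel F) (v∘relabel F))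
             (cong (λ m → (if v F then 2 else 0) + ((if u F then 2 else 0) + m)) (rest∘relabel F uv)))

  choices-pair : ∀ F → choicesL F * choicesL (relabel F) ≤ choicesR F * choicesR (relabel F)
  choices-pair F with u F in uF | v F in vF
  ... | false | false = ≤-reflexive (cong₂ _*_ (choices-away uF vF)
                                               (choices-away (trans (u∘relabel F) vF) (trans (v∘relabel F) uF)))
  ... | true  | _     = near-stars F (cong (_∨ v F) uF)
  ... | false | true  = near-stars F (cong₂ _∨_ uF vF)

  numMaps-≤ : numMaps n r k T C before ≤ numMaps n r k T C′ after
  numMaps-≤ = subst₂ _≤_ (sym (numMaps≡product n r k T C before)) (sym (numMaps≡product n r k T C′ after))
    (product-≤-by-pairing (allSubsets-unique n) ∈-allSubsets relabel-involutive choicesL choicesR choices-pair)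

lemma3p7 : (n k t r : ℕ) → 1 ≤ t → t < k → 7 ≤ r → r % 3 ≡ 1 →
    (T : ℕ → Subset n) →
    (∀ i → 1 ≤ i → i ≤ ⌈ r /3⌉ → ∣ T i ∣ ≡ t) →
    (∀ i j → 1 ≤ i → i < j → j ≤ ⌈ r /3⌉ → ∣ T i ∩ T j ∣ ≤ 2 * t ∸ (k + 1)) →
    (C : ℕ → Subset r) →
    (∀ i j → 1 ≤ i → i ≤ ⌈ r /3⌉ ∸ 1 → 1 ≤ j → j ≤ ⌈ r /3⌉ ∸ 1 → i ≢ j → C i ∩ C j ≡ ⊥) →
    (∀ (x : Fin r) → Σ ℕ (λ i → 1 ≤ i × i ≤ ⌈ r /3⌉ ∸ 1 × x ∈ C i)) →
    ∣ C 1 ∣ ≡ 4 →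
    (∀ i → 2 ≤ i → i ≤ ⌈ r /3⌉ ∸ 1 → ∣ C i ∣ ≡ 3) →
    (A B : Subset r) → A ∩ B ≡ ⊥ → A ∪ B ≡ C 1 → ∣ A ∣ ≡ 2 → ∣ B ∣ ≡ 2 →
    numMaps n r k T C (range 1 (⌈ r /3⌉ ∸ 1))
      ≤ numMaps n r k T (modParts ⌈ r /3⌉ C A B) (range 1 ⌈ r /3⌉)
lemma3p7 n k t r _ _ 7≤r _ T ∣T∣≡t ∣T∩T∣≤ C C-disjoint C-cover ∣C₁∣≡4 _ A B A∩B≡⊥ A∪B≡C₁ ∣A∣≡2 ∣B∣≡2 =
  SplitPart.numMaps-≤ k t ⌈ r /3⌉ 2≤s T ∣T∣≡t ∣T∩T∣≤ C C-disjoint C-cover ∣C₁∣≡4 A B A∩B≡⊥ A∪B≡C₁ ∣A∣≡2 ∣B∣≡2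
  where
  2≤s : 2 ≤ ⌈ r /3⌉
  2≤s = /-monoˡ-≤ 3 (+-monoˡ-≤ 2 (≤-trans (s≤s (s≤s (s≤s (s≤s z≤n)))) 7≤r))
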